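{- Let $h,r,m,n$ be positive integers with $h<m\leq n$, let $V\subseteq[n]$ with $|V|=m$, and let $\mathcal H:=K_n^h\setminus V$. If a partial $r$-factorization of $\mathcal H$ can be extended to an $r$-factorization of $K_n^h$, then (N1) $h\mid rn$; (N2) $r\mid\binom{n-1}{h-1}$; (N3) $\deg_{\mathcal H(i)}(v)=r$ for every $v\in[n]\setminus V$ and every $i\in[k]$; (N4) $|E(\mathcal H(i))|\leq rn/h$ for every $i\in[k]$, where $k:=\binom{n-1}{h-1}/r$.
   Context: $K_n^h$ is the complete $h$-uniform hypergraph with vertex set $[n]$ and edge set $\binom{[n]}{h}$. For $V\subseteq[n]$, $K_n^h\setminus V$ is the hypergraph with vertex set $[n]$ and edge set $\{e\in\binom{[n]}{h} : e\not\subseteq V\}$. For an edge-colored hypergraph $\mathcal H$, $\mathcal H(i)$ is the subhypergraph of edges of color $i$ and $\deg_{\mathcal H(i)}(v)$ the number of edges of color $i$ containing $v$. A partial $r$-factorization of $\mathcal H$ is a coloring of its edges with at most $\binom{n-1}{h-1}/r$ colors such that every vertex lies in at most $r$ edges of each color. An $r$-factorization of $K_n^h$ is a coloring of $\binom{[n]}{h}$ in which every vertex lies in exactly $r$ edges of each color; a partial $r$-factorization of $\mathcal H$ is extended to one if the $h$-subsets of $V$ can be colored so that the resulting coloring of $\binom{[n]}{h}$ is an $r$-factorization. -}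

module Defs where

open import Data.Nat using (ℕ; zero; suc; _+_; _*_; _∸_; _≤_; NonZero)
open import Data.Nat.DivMod using (_/_)
open import Data.Nat.Combinatorics using (_C_)
open import Data.Bool using (Bool; true; false; _∧_; not; if_then_else_)
open import Data.Fin using (Fin)
open import Data.Fin.Subset using (Subset; inside; outside; ∣_∣; _⊆_; _∈_; _∉_)
open import Data.Fin.Subset.Properties using (_⊆?_; _∈?_)
open import Data.Vec using ([]; _∷_)
open import Data.Product using (Σ; _×_)
open import Relation.Nullary using (¬_)
open import Relation.Nullary.Decidable using (⌊_⌋)
open import Relation.Binary.PropositionalEquality using (_≡_)
import Data.Nat.Properties as ℕP
import Data.Fin.Properties as FinP

countSub : (n : ℕ) → (Subset n → Bool) → ℕ
countSub zero    P = if P [] then 1 else 0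
countSub (suc n) P = countSub n (λ e → P (inside ∷ e)) + countSub n (λ e → P (outside ∷ e))

isEdge : ∀ {n} → ℕ → Subset n → Bool
isEdge h e = ⌊ ∣ e ∣ ℕP.≟ h ⌋

isEdgeH : ∀ {n} → ℕ → Subset n → Subset n → Bool
isEdgeH h V e = isEdge h e ∧ not ⌊ e ⊆? V ⌋

numColors : (n h r : ℕ) → .{{NonZero r}} → ℕ
numColors n h r = ((n ∸ 1) C (h ∸ 1)) / r

-- A colouring of the edges of a hypergraph on [n] with colours in Fin k is
-- represented by a total function on subsets; only its values on edges matter.
Colouring : ℕ → ℕ → Set
Colouring n k = Subset n → Fin k

degH : ∀ {n k} → (h : ℕ) → Subset n → Colouring n k → Fin k → Fin n → ℕ
degH {n} h V c i v =
  countSub n (λ e → isEdgeH h V e ∧ ⌊ v ∈? e ⌋ ∧ ⌊ c e FinP.≟ i ⌋)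

degK : ∀ {n k} → (h : ℕ) → Colouring n k → Fin k → Fin n → ℕ
degK {n} h c i v =
  countSub n (λ e → isEdge h e ∧ ⌊ v ∈? e ⌋ ∧ ⌊ c e FinP.≟ i ⌋)

edgesH : ∀ {n k} → (h : ℕ) → Subset n → Colouring n k → Fin k → ℕ
edgesH {n} h V c i = countSub n (λ e → isEdgeH h V e ∧ ⌊ c e FinP.≟ i ⌋)

IsPartialRFactorization : ∀ {n k} → (h r : ℕ) → Subset n → Colouring n k → Set
IsPartialRFactorization h r V c = ∀ i v → degH h V c i v ≤ r

IsRFactorization : ∀ {n k} → (h r : ℕ) → Colouring n k → Set
IsRFactorization h r c = ∀ i v → degK h c i v ≡ r

Extendable : ∀ {n k} → (h r : ℕ) → Subset n → Colouring n k → Set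
Extendable {n} {k} h r V c =
  Σ (Colouring n k) λ c' →
    (∀ (e : Subset n) → ∣ e ∣ ≡ h → ¬ (e ⊆ V) → c' e ≡ c e)
    × IsRFactorization h r c'

-- Let c′ be an r-factorization of K_n^h extending c. Double counting incident pairs (v, e)
-- within a colour class of c′ gives |E(K(i))|·h = n·r, whence (N1) and the bound (N4) once
-- c and c′ are seen to agree on the edges of H; splitting the degree C(n-1, h-1) of a vertex
-- by colour gives k·r, whence (N2). A vertex outside V lies only in edges of H, whence (N3).
module Submission where

open import Defs
open import Data.Nat using (ℕ; zero; suc; _+_; _*_; _∸_; _/_; _≤_; _<_; z≤n; NonZero)
open import Data.Nat.Divisibility using (_∣_; divides)
open import Data.Nat.DivMod using (m*n/n≡m)
open import Data.Nat.Combinatorics using (_C_; nCk+nC[k+1]≡[n+1]C[k+1])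
import Data.Nat.Properties as ℕP
open import Data.Bool using (Bool; true; false; _∧_; T; if_then_else_)
open import Data.Bool.Properties using (∧-zeroʳ; ∧-identityʳ; ∧-assoc)
open import Data.Vec using ([]; _∷_; there)
open import Data.Fin using (Fin; zero; suc)
open import Data.Fin.Subset using (Subset; inside; outside; ∣_∣; _∉_; _⊆_)
open import Data.Fin.Subset.Properties using (_∈?_; _⊆?_; drop-there)
import Data.Fin.Properties as FinP
open import Data.Product using (_×_; _,_)
open import Data.Empty using (⊥-elim)
open import Function using (_∘_; _⇔_; mk⇔)
open import Relation.Nullary using (Dec; yes; no; ¬_)
open import Relation.Nullary.Decidable using (⌊_⌋; does-⇔; isYes≗does)
open import Relation.Binary.PropositionalEquality
  using (_≡_; _≗_; refl; sym; trans; cong; cong₂; subst; module ≡-Reasoning)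
open import Algebra.Properties.CommutativeMonoid.Sum ℕP.+-0-commutativeMonoid
  using (sum-syntax; sum-cong-≗; sum-replicate-zero; ∑-distrib-+)

⌊⌋-⇔ : ∀ {a b} {A : Set a} {B : Set b} → A ⇔ B → (a? : Dec A) (b? : Dec B) → ⌊ a? ⌋ ≡ ⌊ b? ⌋
⌊⌋-⇔ A⇔B a? b? = trans (isYes≗does a?) (trans (does-⇔ A⇔B a? b?) (sym (isYes≗does b?)))

ℕ-⌊suc≟suc⌋ : ∀ a b → ⌊ suc a ℕP.≟ suc b ⌋ ≡ ⌊ a ℕP.≟ b ⌋
ℕ-⌊suc≟suc⌋ a b = ⌊⌋-⇔ (mk⇔ ℕP.suc-injective (cong suc)) (suc a ℕP.≟ suc b) (a ℕP.≟ b)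

⌊suc∈?∷⌋ : ∀ {n} (v : Fin n) s (p : Subset n) → ⌊ suc v ∈? (s ∷ p) ⌋ ≡ ⌊ v ∈? p ⌋
⌊suc∈?∷⌋ v s p = ⌊⌋-⇔ (mk⇔ drop-there there) (suc v ∈? (s ∷ p)) (v ∈? p)

Fin-⌊suc≟suc⌋ : ∀ {k} (x i : Fin k) → ⌊ suc x FinP.≟ suc i ⌋ ≡ ⌊ x FinP.≟ i ⌋
Fin-⌊suc≟suc⌋ x i = ⌊⌋-⇔ (mk⇔ FinP.suc-injective (cong suc)) (suc x FinP.≟ suc i) (x FinP.≟ i)

𝟙 : Bool → ℕ
𝟙 b = if b then 1 else 0

sumOverSubsets : (n : ℕ) → (Subset n → ℕ) → ℕ
sumOverSubsets zero    f = f []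
sumOverSubsets (suc n) f =
  sumOverSubsets n (λ e → f (inside ∷ e)) + sumOverSubsets n (λ e → f (outside ∷ e))

countSub≡sumOverSubsets : ∀ n P → countSub n P ≡ sumOverSubsets n (𝟙 ∘ P)
countSub≡sumOverSubsets zero    P = refl
countSub≡sumOverSubsets (suc n) P =
  cong₂ _+_ (countSub≡sumOverSubsets n _) (countSub≡sumOverSubsets n _)

sumOverSubsets-cong : ∀ n {f g : Subset n → ℕ} → f ≗ g → sumOverSubsets n f ≡ sumOverSubsets n g
sumOverSubsets-cong zero    f≗g = f≗g []
sumOverSubsets-cong (suc n) f≗g =
  cong₂ _+_ (sumOverSubsets-cong n (f≗g ∘ (inside ∷_))) (sumOverSubsets-cong n (f≗g ∘ (outside ∷_)))

sumOverSubsets-*ʳ : ∀ n (f : Subset n → ℕ) m →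
  sumOverSubsets n (λ e → f e * m) ≡ sumOverSubsets n f * m
sumOverSubsets-*ʳ zero    f m = refl
sumOverSubsets-*ʳ (suc n) f m =
  trans (cong₂ _+_ (sumOverSubsets-*ʳ n _ m) (sumOverSubsets-*ʳ n _ m))
        (sym (ℕP.*-distribʳ-+ m (sumOverSubsets n _) (sumOverSubsets n _)))

sumOverSubsets-∑-comm : ∀ n k (g : Fin k → Subset n → ℕ) →
  sumOverSubsets n (λ e → ∑[ i < k ] g i e) ≡ ∑[ i < k ] sumOverSubsets n (g i)
sumOverSubsets-∑-comm zero    k g = refl
sumOverSubsets-∑-comm (suc n) k g =
  trans (cong₂ _+_ (sumOverSubsets-∑-comm n k _) (sumOverSubsets-∑-comm n k _))
        (sym (∑-distrib-+ (λ i → sumOverSubsets n (λ e → g i (inside ∷ e)))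
                          (λ i → sumOverSubsets n (λ e → g i (outside ∷ e)))))

countSub-cong : ∀ n {P Q : Subset n → Bool} → P ≗ Q → countSub n P ≡ countSub n Q
countSub-cong zero    P≗Q = cong 𝟙 (P≗Q [])
countSub-cong (suc n) P≗Q =
  cong₂ _+_ (countSub-cong n (P≗Q ∘ (inside ∷_))) (countSub-cong n (P≗Q ∘ (outside ∷_)))

𝟙-mono : ∀ {a b} → (T a → T b) → 𝟙 a ≤ 𝟙 b
𝟙-mono {false}         a⇒b = z≤n
𝟙-mono {true}  {true}  a⇒b = ℕP.≤-refl
𝟙-mono {true}  {false} a⇒b = ⊥-elim (a⇒b _)

countSub-mono : ∀ n {P Q : Subset n → Bool} → (∀ e → T (P e) → T (Q e)) →
  countSub n P ≤ countSub n Q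
countSub-mono zero    P⇒Q = 𝟙-mono (P⇒Q [])
countSub-mono (suc n) P⇒Q =
  ℕP.+-mono-≤ (countSub-mono n (P⇒Q ∘ (inside ∷_))) (countSub-mono n (P⇒Q ∘ (outside ∷_)))

countSub-false : ∀ n → countSub n (λ _ → false) ≡ 0
countSub-false zero    = refl
countSub-false (suc n) = cong₂ _+_ (countSub-false n) (countSub-false n)

countSub-isEdge : ∀ n j → countSub n (isEdge j) ≡ n C j
countSub-isEdge zero    zero    = refl
countSub-isEdge zero    (suc j) = refl
countSub-isEdge (suc n) zero    =
  cong₂ _+_ (trans (countSub-cong n (λ _ → refl)) (countSub-false n)) (countSub-isEdge n 0)
countSub-isEdge (suc n) (suc j) = begin
  countSub n (λ e → ⌊ suc ∣ e ∣ ℕP.≟ suc j ⌋) + countSub n (isEdge (suc j))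
    ≡⟨ cong₂ _+_ (countSub-cong n (λ e → ℕ-⌊suc≟suc⌋ ∣ e ∣ j)) refl ⟩
  countSub n (isEdge j) + countSub n (isEdge (suc j))
    ≡⟨ cong₂ _+_ (countSub-isEdge n j) (countSub-isEdge n (suc j)) ⟩
  n C j + n C suc j
    ≡⟨ nCk+nC[k+1]≡[n+1]C[k+1] n j ⟩
  suc n C suc j ∎
  where open ≡-Reasoning

degreeK : ∀ {n} → ℕ → Fin n → ℕ
degreeK {n} h v = countSub n (λ e → isEdge h e ∧ ⌊ v ∈? e ⌋)

edgesK : ∀ {n k} → ℕ → Colouring n k → Fin k → ℕ
edgesK {n} h c i = countSub n (λ e → isEdge h e ∧ ⌊ c e FinP.≟ i ⌋)

degreeK-zero : ∀ n j → degreeK {suc n} (suc j) zero ≡ n C j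
degreeK-zero n j = begin
  countSub n (λ e → ⌊ suc ∣ e ∣ ℕP.≟ suc j ⌋ ∧ true) + countSub n (λ e → isEdge (suc j) e ∧ false)
    ≡⟨ cong₂ _+_ (countSub-cong n (λ e → trans (∧-identityʳ _) (ℕ-⌊suc≟suc⌋ ∣ e ∣ j)))
                 (trans (countSub-cong n (λ e → ∧-zeroʳ _)) (countSub-false n)) ⟩
  countSub n (isEdge j) + 0
    ≡⟨ ℕP.+-identityʳ _ ⟩
  countSub n (isEdge j)
    ≡⟨ countSub-isEdge n j ⟩
  n C j ∎
  where open ≡-Reasoning

∑-const : ∀ k m → ∑[ i < k ] m ≡ k * m
∑-const zero    m = refl
∑-const (suc k) m = cong (m +_) (∑-const k m)

∑-𝟙-∈ : ∀ {n} (e : Subset n) → ∑[ v < n ] 𝟙 ⌊ v ∈? e ⌋ ≡ ∣ e ∣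
∑-𝟙-∈ []           = refl
∑-𝟙-∈ (inside ∷ e)  =
  cong suc (trans (sum-cong-≗ (λ v → cong 𝟙 (⌊suc∈?∷⌋ v inside e))) (∑-𝟙-∈ e))
∑-𝟙-∈ (outside ∷ e) = trans (sum-cong-≗ (λ v → cong 𝟙 (⌊suc∈?∷⌋ v outside e))) (∑-𝟙-∈ e)

∑-𝟙-≟ : ∀ {k} (x : Fin k) → ∑[ i < k ] 𝟙 ⌊ x FinP.≟ i ⌋ ≡ 1
∑-𝟙-≟ {suc k} zero    = cong suc (sum-replicate-zero k)
∑-𝟙-≟ {suc k} (suc x) = trans (sum-cong-≗ (λ i → cong 𝟙 (Fin-⌊suc≟suc⌋ x i))) (∑-𝟙-≟ x)

∑-𝟙-∧-≟ : ∀ {k} b (x : Fin k) → ∑[ i < k ] 𝟙 (b ∧ ⌊ x FinP.≟ i ⌋) ≡ 𝟙 b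
∑-𝟙-∧-≟ {k} false x = sum-replicate-zero k
∑-𝟙-∧-≟     true  x = ∑-𝟙-≟ x

∑-𝟙-∈-∧ : ∀ {n} (e : Subset n) b → ∑[ v < n ] 𝟙 (⌊ v ∈? e ⌋ ∧ b) ≡ 𝟙 b * ∣ e ∣
∑-𝟙-∈-∧ {n} e true  =
  trans (sum-cong-≗ {n} (λ v → cong 𝟙 (∧-identityʳ ⌊ v ∈? e ⌋)))
        (trans (∑-𝟙-∈ e) (sym (ℕP.*-identityˡ ∣ e ∣)))
∑-𝟙-∈-∧ {n} e false =
  trans (sum-cong-≗ {n} (λ v → cong 𝟙 (∧-zeroʳ ⌊ v ∈? e ⌋))) (sum-replicate-zero n)

∑-𝟙-isEdge-∋ : ∀ {n} h (e : Subset n) b →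
  ∑[ v < n ] 𝟙 (isEdge h e ∧ (⌊ v ∈? e ⌋ ∧ b)) ≡ 𝟙 (isEdge h e ∧ b) * h
∑-𝟙-isEdge-∋ {n} h e b with ∣ e ∣ ℕP.≟ h
... | no  _    = sum-replicate-zero n
... | yes refl = ∑-𝟙-∈-∧ e b

countSub-∑-colours : ∀ n {k} (c : Subset n → Fin k) (Q : Subset n → Bool) →
  ∑[ i < k ] countSub n (λ e → Q e ∧ ⌊ c e FinP.≟ i ⌋) ≡ countSub n Q
countSub-∑-colours n {k} c Q = begin
  ∑[ i < k ] countSub n (λ e → Q e ∧ ⌊ c e FinP.≟ i ⌋)
    ≡⟨ sum-cong-≗ {k} (λ i → countSub≡sumOverSubsets n _) ⟩
  ∑[ i < k ] sumOverSubsets n (λ e → 𝟙 (Q e ∧ ⌊ c e FinP.≟ i ⌋))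
    ≡⟨ sumOverSubsets-∑-comm n k _ ⟨
  sumOverSubsets n (λ e → ∑[ i < k ] 𝟙 (Q e ∧ ⌊ c e FinP.≟ i ⌋))
    ≡⟨ sumOverSubsets-cong n (λ e → ∑-𝟙-∧-≟ (Q e) (c e)) ⟩
  sumOverSubsets n (𝟙 ∘ Q)
    ≡⟨ countSub≡sumOverSubsets n Q ⟨
  countSub n Q ∎
  where open ≡-Reasoning

handshake : ∀ n h (P : Subset n → Bool) →
  ∑[ v < n ] countSub n (λ e → isEdge h e ∧ (⌊ v ∈? e ⌋ ∧ P e))
    ≡ countSub n (λ e → isEdge h e ∧ P e) * h
handshake n h P = begin
  ∑[ v < n ] countSub n (λ e → isEdge h e ∧ (⌊ v ∈? e ⌋ ∧ P e))
    ≡⟨ sum-cong-≗ {n} (λ v → countSub≡sumOverSubsets n _) ⟩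
  ∑[ v < n ] sumOverSubsets n (λ e → 𝟙 (isEdge h e ∧ (⌊ v ∈? e ⌋ ∧ P e)))
    ≡⟨ sumOverSubsets-∑-comm n n _ ⟨
  sumOverSubsets n (λ e → ∑[ v < n ] 𝟙 (isEdge h e ∧ (⌊ v ∈? e ⌋ ∧ P e)))
    ≡⟨ sumOverSubsets-cong n (λ e → ∑-𝟙-isEdge-∋ h e (P e)) ⟩
  sumOverSubsets n (λ e → 𝟙 (isEdge h e ∧ P e) * h)
    ≡⟨ sumOverSubsets-*ʳ n _ h ⟩
  sumOverSubsets n (λ e → 𝟙 (isEdge h e ∧ P e)) * h
    ≡⟨ cong (_* h) (countSub≡sumOverSubsets n _) ⟨
  countSub n (λ e → isEdge h e ∧ P e) * h ∎
  where open ≡-Reasoning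

module RFactorization {n k h r} {c : Colouring n k} (fac : IsRFactorization h r c) where

  edgesK*h≡n*r : ∀ i → edgesK h c i * h ≡ n * r
  edgesK*h≡n*r i = trans (sym (handshake n h _)) (trans (sum-cong-≗ (fac i)) (∑-const n r))

  degreeK≡k*r : ∀ v → degreeK h v ≡ k * r
  degreeK≡k*r v = begin
    degreeK h v
      ≡⟨ countSub-∑-colours n c _ ⟨
    ∑[ i < k ] countSub n (λ e → (isEdge h e ∧ ⌊ v ∈? e ⌋) ∧ ⌊ c e FinP.≟ i ⌋)
      ≡⟨ sum-cong-≗ (λ i → trans (countSub-cong n (λ e → ∧-assoc (isEdge h e) _ _)) (fac i v)) ⟩
    ∑[ i < k ] r
      ≡⟨ ∑-const k r ⟩
    k * r ∎
    where open ≡-Reasoning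

module _ {n k h} {V : Subset n} {c c′ : Colouring n k}
         (agree : ∀ e → ∣ e ∣ ≡ h → ¬ (e ⊆ V) → c′ e ≡ c e) where

  degH≡degK-outside : ∀ i v → v ∉ V → degH h V c i v ≡ degK h c′ i v
  degH≡degK-outside i v v∉V = countSub-cong n pointwise
    where
    pointwise : ∀ e → isEdgeH h V e ∧ (⌊ v ∈? e ⌋ ∧ ⌊ c e FinP.≟ i ⌋)
                    ≡ isEdge h e ∧ (⌊ v ∈? e ⌋ ∧ ⌊ c′ e FinP.≟ i ⌋)
    pointwise e with ∣ e ∣ ℕP.≟ h | v ∈? e | e ⊆? V
    ... | no  _     | _       | _       = refl
    ... | yes _     | no  _   | _       = ∧-zeroʳ _
    ... | yes _     | yes v∈e | yes e⊆V = ⊥-elim (v∉V (e⊆V v∈e))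
    ... | yes |e|≡h | yes _   | no  e⊈V = cong (λ x → ⌊ x FinP.≟ i ⌋) (sym (agree e |e|≡h e⊈V))

  edgesH≤edgesK : ∀ i → edgesH h V c i ≤ edgesK h c′ i
  edgesH≤edgesK i = countSub-mono n pointwise
    where
    pointwise : ∀ e → T (isEdgeH h V e ∧ ⌊ c e FinP.≟ i ⌋) → T (isEdge h e ∧ ⌊ c′ e FinP.≟ i ⌋)
    pointwise e with ∣ e ∣ ℕP.≟ h | e ⊆? V
    ... | no  _     | _      = λ ()
    ... | yes _     | yes _  = λ ()
    ... | yes |e|≡h | no e⊈V = subst (λ x → T ⌊ x FinP.≟ i ⌋) (sym (agree e |e|≡h e⊈V))

mainTheorem4 : (h r m n : ℕ) → .{{_ : NonZero h}} → .{{_ : NonZero r}} →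
    h < m → m ≤ n → (V : Subset n) → ∣ V ∣ ≡ m →
    (c : Colouring n (numColors n h r)) →
    IsPartialRFactorization h r V c →
    Extendable h r V c →
    (h ∣ r * n)
    × (r ∣ ((n ∸ 1) C (h ∸ 1)))
    × (∀ (v : Fin n) → v ∉ V → ∀ i → degH h V c i v ≡ r)
    × (∀ i → edgesH h V c i ≤ (r * n) / h)
mainTheorem4 zero _ _ _ {{()}}
mainTheorem4 (suc _) _ _ zero h<m m≤n _ _ _ _ _ = ⊥-elim (ℕP.n≮0 (ℕP.<-≤-trans h<m m≤n))
mainTheorem4 h@(suc j) r _ n@(suc n′) _ _ V _ c _ (c′ , agree , fac) =
  divides (edgesK h c′ (c V)) (r*n≡edgesK*h (c V)) ,
  divides k (trans (sym (degreeK-zero n′ j)) (degreeK≡k*r zero)) ,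
  (λ v v∉V i → trans (degH≡degK-outside agree i v v∉V) (fac i v)) ,
  λ i → subst (edgesH h V c i ≤_) (sym (r*n/h≡edgesK i)) (edgesH≤edgesK agree i)
  where
  -- any value of c is a colour, so k > 0 and the colour class of c V witnesses (N1)
  k = numColors n h r
  open RFactorization {h = h} {r = r} {c = c′} fac
  r*n≡edgesK*h : ∀ i → r * n ≡ edgesK h c′ i * h
  r*n≡edgesK*h i = trans (ℕP.*-comm r n) (sym (edgesK*h≡n*r i))
  r*n/h≡edgesK : ∀ i → (r * n) / h ≡ edgesK h c′ i
  r*n/h≡edgesK i = trans (cong (_/ h) (r*n≡edgesK*h i)) (m*n/n≡m (edgesK h c′ i) h)
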